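{- Let $v_1(n)$ be the number of permutations of $[n]$ containing exactly one occurrence of the pattern $23\text{ - }1$, and $V_1(x)=\sum_{n\ge0}v_1(n)x^n$. Then, as formal power series, $$V_1(x)=\sum_{n\ge1}\frac{x}{1-(n-1)x}\sum_{k\ge0}\frac{k\,x^{k+n}}{(1-x)(1-2x)\cdots(1-(k+n)x)}.$$
   Context: An occurrence of the pattern $23\text{ - }1$ in a permutation $a_1a_2\cdots a_n$ is a pair of indices $(i,j)$ with $1\le i$, $i+1<j\le n$, such that $a_j<a_i<a_{i+1}$ (the first two letters adjacent in the permutation). -}

module Defs where

open import Data.Nat using (ℕ; zero; suc; _+_; _*_; _∸_; _^_; _<_; _<?_)
open import Data.Nat.Properties using (_≟_)
open import Data.List using (List; []; _∷_; map; upTo; foldr; length; filter; cartesianProduct; concatMap)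
open import Data.Product using (_×_; _,_; proj₁; proj₂)
open import Data.Nat.ListAction using (sum)
open import Relation.Nullary.Decidable using (_×-dec_)
open import Relation.Binary.PropositionalEquality using (_≡_)
open import Data.List.Relation.Unary.Unique.DecPropositional _≟_ using (Unique; unique?)

words : ℕ → List ℕ → List (List ℕ)
words zero    alph = [] ∷ []
words (suc m) alph = concatMap (λ a → map (a ∷_) (words m alph)) alph

[_] : ℕ → List ℕ
[ n ] = map suc (upTo n)

perms : ℕ → List (List ℕ)
perms n = filter unique? (words n [ n ])

-- 0-based letter access a_{i+1} = at w i (default 0 outside range; never used there)
at : List ℕ → ℕ → ℕ
at []      _       = 0
at (x ∷ w) zero    = x
at (x ∷ w) (suc i) = at w i

Occ : List ℕ → ℕ × ℕ → Set
Occ w (i , j) = (suc i < j × j < length w) × (at w j < at w i × at w i < at w (suc i))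

occ? : (w : List ℕ) → (p : ℕ × ℕ) → Relation.Nullary.Decidable.Dec (Occ w p)
occ? w (i , j) = (suc i <? j ×-dec j <? length w) ×-dec (at w j <? at w i ×-dec at w i <? at w (suc i))

occurrences : List ℕ → ℕ
occurrences w = length (filter (occ? w) (cartesianProduct (upTo (length w)) (upTo (length w))))

v₁ : ℕ → ℕ
v₁ n = length (filter (λ w → occurrences w ≟ 1) (perms n))

-- Formal power series in x with ℕ coefficients: f m = [x^m] f.

PS : Set
PS = ℕ → ℕ

_⊛_ : PS → PS → PS
(f ⊛ g) m = sum (map (λ i → f i * g (m ∸ i)) (upTo (suc m)))
infixl 7 _⊛_

mono : ℕ → ℕ → PS
mono c d m with m ≟ d
... | Relation.Nullary.Decidable.yes _ = c
... | Relation.Nullary.Decidable.no  _ = 0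

-- 1/(1 - c x) = Σ_m c^m x^m
inv1m : ℕ → PS
inv1m c m = c ^ m

invProd : ℕ → PS
invProd zero    = mono 1 0
invProd (suc K) = invProd K ⊛ inv1m (suc K)

term : ℕ → ℕ → PS
term n k = mono 1 1 ⊛ inv1m (n ∸ 1) ⊛ mono k (k + n) ⊛ invProd (k + n)

-- Right-hand side  Σ_{n≥1} Σ_{k≥0} term n k.  Since term n k has order
-- ≥ k+n+1, only n ∈ [1,N], k ∈ [0,N] contribute to [x^N]; the sum is
-- therefore computed coefficientwise as this finite sum.
rhs : PS
rhs N = sum (map (λ n → sum (map (λ k → term n k N) (upTo (suc N)))) [ N ])

V₁ : PS
V₁ = v₁

module Submission where

-- Write a permutation of [n+1] as its first letter i+1 followed by the standardisation of the rest, a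
-- permutation of [n] with first letter j+1. The new first pair creates no 23-1 occurrence if j < i and
-- exactly i of them otherwise, as then all i smaller letters come later. So the numbers of permutations
-- of [n+1] with first letter i+1 and no, resp. one, occurrence satisfy recurrences triangular in i.
-- Weighting them by C(n-i+r, n-i) turns the triangular part into a shift of r (hockey-stick identity);
-- this gives Bell(n+1) avoiders of [n+1], and then
--   v₁(n+1) = Σ_M C(n,M) v₁(M) + Σ_k k S(n,k+1).
-- In the (n,k)-summand of the right-hand side the coefficient of x^N is k Σⱼ (n-1)^(N-1-j) S(j,k+n), and
-- the binomial transform in N shifts both n and N by one; so the right-hand side obeys the same recurrence.

open import Defs
open import Data.Bool using (Bool; true; false; if_then_else_; _∧_)
open import Data.Bool.Properties using (∧-identityʳ; ∧-zeroʳ)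
open import Data.Empty using (⊥-elim)
open import Data.List
  using (List; []; _∷_; map; upTo; applyUpTo; length; filter; concatMap; _++_; cartesianProduct)
open import Data.List.Membership.Propositional using (_∈_)
open import Data.List.Properties using (map-∘; map-upTo; map-cong)
open import Data.List.Relation.Unary.All as All using (All)
open import Data.List.Relation.Unary.All.Properties as All using ()
open import Data.List.Relation.Unary.AllPairs using (_∷_)
open import Data.List.Relation.Unary.Any using (here; there)
open import Data.List.Relation.Unary.Unique.Propositional.Properties using (map⁺; map⁻)
open import Data.Nat
open import Data.Nat.Combinatorics using (_C_; nCn≡1; k>n⇒nCk≡0; nCk+nC[k+1]≡[n+1]C[k+1])
open import Data.Nat.Induction using (<-rec)
open import Data.Nat.ListAction using (sum)
open import Data.Nat.Properties
open import Data.List.Relation.Unary.Unique.DecPropositional _≟_ using (unique?)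
open import Data.Product using (_×_; _,_)
open import Function using (_∘_; _$_)
open import Function.Bundles using (mk⇔)
open import Relation.Binary.PropositionalEquality hiding ([_])
open import Relation.Nullary using (Dec; does; ¬?; yes; no)
open import Relation.Nullary.Decidable using (dec-true; dec-false; does-⇔)
open import Relation.Nullary.Reflects using (ofʸ; ofⁿ)
open import Algebra.Properties.CommutativeSemigroup +-commutativeSemigroup
  using () renaming (interchange to +-interchange; x∙yz≈xz∙y to +-assoc-comm; x∙yz≈y∙xz to +-left-comm)
open import Algebra.Properties.CommutativeSemigroup *-commutativeSemigroup
  using () renaming (x∙yz≈y∙xz to *-left-comm; x∙yz≈z∙yx to *-rotate)
open ≡-Reasoning

-- Finite sums

𝟙 : Bool → ℕ
𝟙 true  = 1
𝟙 false = 0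

∑< : ℕ → (ℕ → ℕ) → ℕ
∑< zero    f = 0
∑< (suc n) f = f 0 + ∑< n (f ∘ suc)

syntax ∑< n (λ i → e) = ∑[ i < n ] e

∑<-cong : ∀ n {f g} → (∀ i → i < n → f i ≡ g i) → ∑< n f ≡ ∑< n g
∑<-cong zero    f≗g = refl
∑<-cong (suc n) f≗g = cong₂ _+_ (f≗g 0 z<s) (∑<-cong n (λ i i<n → f≗g (suc i) (s<s i<n)))

∑<-+ : ∀ n f g → ∑[ i < n ] (f i + g i) ≡ ∑< n f + ∑< n g
∑<-+ zero    f g = refl
∑<-+ (suc n) f g = trans (cong (f 0 + g 0 +_) (∑<-+ n (f ∘ suc) (g ∘ suc)))
                         (+-interchange (f 0) (g 0) _ _)

∑<-*ˡ : ∀ n c f → ∑[ i < n ] (c * f i) ≡ c * ∑< n f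
∑<-*ˡ zero    c f = sym (*-zeroʳ c)
∑<-*ˡ (suc n) c f = trans (cong (c * f 0 +_) (∑<-*ˡ n c (f ∘ suc))) (sym (*-distribˡ-+ c (f 0) _))

∑<-zero : ∀ n {f} → (∀ i → i < n → f i ≡ 0) → ∑< n f ≡ 0
∑<-zero zero    f≗0 = refl
∑<-zero (suc n) f≗0 = cong₂ _+_ (f≗0 0 z<s) (∑<-zero n (λ i i<n → f≗0 (suc i) (s<s i<n)))

∑<-comm : ∀ m n (f : ℕ → ℕ → ℕ) → ∑[ i < m ] ∑< n (f i) ≡ ∑[ j < n ] ∑[ i < m ] f i j
∑<-comm zero    n f = sym (∑<-zero n (λ _ _ → refl))
∑<-comm (suc m) n f = begin
  ∑< n (f 0) + ∑[ i < m ] ∑< n (f (suc i))        ≡⟨ cong (∑< n (f 0) +_) (∑<-comm m n (f ∘ suc)) ⟩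
  ∑< n (f 0) + ∑[ j < n ] ∑[ i < m ] f (suc i) j  ≡⟨ ∑<-+ n (f 0) _ ⟨
  ∑[ j < n ] ∑[ i < suc m ] f i j                 ∎

∑<-suc : ∀ n f → ∑< (suc n) f ≡ ∑< n f + f n
∑<-suc zero    f = +-comm (f 0) 0
∑<-suc (suc n) f = trans (cong (f 0 +_) (∑<-suc n (f ∘ suc))) (sym (+-assoc (f 0) _ _))

∑<-extend : ∀ {m n} f → m ≤ n → (∀ i → m ≤ i → f i ≡ 0) → ∑< n f ≡ ∑< m f
∑<-extend {zero}  {n}     f _         f≗0 = ∑<-zero n (λ i _ → f≗0 i z≤n)
∑<-extend {suc m} {suc n} f (s≤s m≤n) f≗0 =
  cong (f 0 +_) (∑<-extend (f ∘ suc) m≤n (λ i m≤i → f≗0 (suc i) (s≤s m≤i)))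

∑<-single : ∀ {n a} f → a < n → (∀ i → i ≢ a → f i ≡ 0) → ∑< n f ≡ f a
∑<-single {suc n} {zero}  f _         f≗0 =
  trans (cong (f 0 +_) (∑<-zero n (λ i _ → f≗0 (suc i) λ ()))) (+-identityʳ (f 0))
∑<-single {suc n} {suc a} f (s<s a<n) f≗0 =
  cong₂ _+_ (f≗0 0 λ ()) (∑<-single (f ∘ suc) a<n (λ i i≢a → f≗0 (suc i) (i≢a ∘ suc-injective)))

∑<-reverse : ∀ n f → ∑< n f ≡ ∑[ i < n ] f (n ∸ suc i)
∑<-reverse zero    f = refl
∑<-reverse (suc n) f = begin
  ∑< (suc n) f                         ≡⟨ ∑<-suc n f ⟩
  ∑< n f + f n                         ≡⟨ cong (_+ f n) (∑<-reverse n f) ⟩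
  ∑[ i < n ] f (n ∸ suc i) + f n       ≡⟨ +-comm _ (f n) ⟩
  ∑[ i < suc n ] f (suc n ∸ suc i)     ∎

sumBy : {A : Set} → (A → ℕ) → List A → ℕ
sumBy f xs = sum (map f xs)

module _ {A : Set} where

  sumBy-cong : ∀ {f g : A → ℕ} → (∀ x → f x ≡ g x) → ∀ xs → sumBy f xs ≡ sumBy g xs
  sumBy-cong f≗g []       = refl
  sumBy-cong f≗g (x ∷ xs) = cong₂ _+_ (f≗g x) (sumBy-cong f≗g xs)

  sumBy-++ : ∀ (f : A → ℕ) xs ys → sumBy f (xs ++ ys) ≡ sumBy f xs + sumBy f ys
  sumBy-++ f []       ys = refl
  sumBy-++ f (x ∷ xs) ys = trans (cong (f x +_) (sumBy-++ f xs ys)) (sym (+-assoc (f x) _ _))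

  sumBy-+ : ∀ (f g : A → ℕ) xs → sumBy (λ x → f x + g x) xs ≡ sumBy f xs + sumBy g xs
  sumBy-+ f g []       = refl
  sumBy-+ f g (x ∷ xs) = trans (cong (f x + g x +_) (sumBy-+ f g xs)) (+-interchange (f x) (g x) _ _)

  sumBy-*ˡ : ∀ c (f : A → ℕ) xs → sumBy (λ x → c * f x) xs ≡ c * sumBy f xs
  sumBy-*ˡ c f []       = sym (*-zeroʳ c)
  sumBy-*ˡ c f (x ∷ xs) = trans (cong (c * f x +_) (sumBy-*ˡ c f xs)) (sym (*-distribˡ-+ c (f x) _))

  sumBy-zero : ∀ {f : A → ℕ} → (∀ x → f x ≡ 0) → ∀ xs → sumBy f xs ≡ 0
  sumBy-zero f≗0 []       = refl
  sumBy-zero f≗0 (x ∷ xs) = cong₂ _+_ (f≗0 x) (sumBy-zero f≗0 xs)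

  sumBy-filter : ∀ {P : A → Set} (P? : ∀ x → Dec (P x)) (f : A → ℕ) xs →
                 sumBy f (filter P? xs) ≡ sumBy (λ x → if does (P? x) then f x else 0) xs
  sumBy-filter P? f []       = refl
  sumBy-filter P? f (x ∷ xs) with does (P? x)
  ... | true  = cong (f x +_) (sumBy-filter P? f xs)
  ... | false = sumBy-filter P? f xs

  length-filter : ∀ {P : A → Set} (P? : ∀ x → Dec (P x)) xs →
                  length (filter P? xs) ≡ sumBy (𝟙 ∘ does ∘ P?) xs
  length-filter P? []       = refl
  length-filter P? (x ∷ xs) with does (P? x)
  ... | true  = cong suc (length-filter P? xs)
  ... | false = length-filter P? xs

  sumBy-applyUpTo : ∀ (f : A → ℕ) g n → sumBy f (applyUpTo g n) ≡ ∑< n (f ∘ g)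
  sumBy-applyUpTo f g zero    = refl
  sumBy-applyUpTo f g (suc n) = cong (f (g 0) +_) (sumBy-applyUpTo f (g ∘ suc) n)

sumBy-map : ∀ {A B : Set} (f : B → ℕ) (g : A → B) xs → sumBy f (map g xs) ≡ sumBy (f ∘ g) xs
sumBy-map f g xs = cong sum (sym (map-∘ xs))

module _ {A B : Set} where

  sumBy-concatMap : ∀ (f : B → ℕ) (g : A → List B) xs →
                    sumBy f (concatMap g xs) ≡ sumBy (sumBy f ∘ g) xs
  sumBy-concatMap f g []       = refl
  sumBy-concatMap f g (x ∷ xs) =
    trans (sumBy-++ f (g x) _) (cong (sumBy f (g x) +_) (sumBy-concatMap f g xs))

  sumBy-cartesianProduct : ∀ (f : A × B → ℕ) xs ys →
    sumBy f (cartesianProduct xs ys) ≡ sumBy (λ x → sumBy (λ y → f (x , y)) ys) xs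
  sumBy-cartesianProduct f []       ys = refl
  sumBy-cartesianProduct f (x ∷ xs) ys =
    trans (sumBy-++ f (map (x ,_) ys) _)
          (cong₂ _+_ (sumBy-map f (x ,_) ys) (sumBy-cartesianProduct f xs ys))

sumBy-upTo : ∀ f n → sumBy f (upTo n) ≡ ∑< n f
sumBy-upTo f = sumBy-applyUpTo f (λ i → i)

∑<-indicator : ∀ {n a} (f : ℕ → ℕ) c → a < n → ∑[ i < n ] (f i * (𝟙 (i ≡ᵇ a) * c)) ≡ f a * c
∑<-indicator {n} {a} f c a<n = begin
  ∑[ i < n ] (f i * (𝟙 (i ≡ᵇ a) * c))   ≡⟨ ∑<-single (λ i → f i * (𝟙 (i ≡ᵇ a) * c)) a<n off ⟩
  f a * (𝟙 (a ≡ᵇ a) * c)                ≡⟨ cong (λ b → f a * (𝟙 b * c)) (dec-true (a ≟ a) refl) ⟩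
  f a * (1 * c)                         ≡⟨ cong (f a *_) (*-identityˡ c) ⟩
  f a * c                               ∎
  where
  off : ∀ i → i ≢ a → f i * (𝟙 (i ≡ᵇ a) * c) ≡ 0
  off i i≢a = trans (cong (λ b → f i * (𝟙 b * c)) (dec-false (i ≟ a) i≢a)) (*-zeroʳ (f i))

-- Binomial transform, Stirling and Bell numbers

∑<-C-hockey : ∀ k r → ∑[ t < suc k ] ((t + r) C t) ≡ (k + suc r) C k
∑<-C-hockey zero    r = refl
∑<-C-hockey (suc k) r = begin
  ∑[ t < suc (suc k) ] ((t + r) C t)            ≡⟨ ∑<-suc (suc k) (λ t → (t + r) C t) ⟩
  ∑[ t < suc k ] ((t + r) C t) + (suc k + r) C suc k
    ≡⟨ cong₂ (λ a b → a + b C suc k) (∑<-C-hockey k r) (sym (+-suc k r)) ⟩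
  (k + suc r) C k + (k + suc r) C suc k       ≡⟨ nCk+nC[k+1]≡[n+1]C[k+1] (k + suc r) k ⟩
  (suc k + suc r) C suc k                      ∎

∑<-above : ∀ N j f → ∑[ i < suc N ] (𝟙 (j <ᵇ i) * f (N ∸ i)) ≡ ∑< (N ∸ j) f
∑<-above N       zero    f =
  trans (∑<-cong N (λ i _ → *-identityˡ (f (N ∸ suc i)))) (sym (∑<-reverse N f))
∑<-above zero    (suc j) f = refl
∑<-above (suc N) (suc j) f = ∑<-above N j f

binomialTransform : (ℕ → ℕ) → ℕ → ℕ
binomialTransform f N = ∑[ M < suc N ] ((N C M) * f M)

binomialTransform-cong : ∀ N {f g} → (∀ M → M ≤ N → f M ≡ g M) →
                         binomialTransform f N ≡ binomialTransform g N
binomialTransform-cong N f≗g = ∑<-cong (suc N) (λ M M<1+N → cong ((N C M) *_) (f≗g M (s≤s⁻¹ M<1+N)))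

binomialTransform-+ : ∀ N f g →
  binomialTransform (λ M → f M + g M) N ≡ binomialTransform f N + binomialTransform g N
binomialTransform-+ N f g =
  trans (∑<-cong (suc N) (λ M _ → *-distribˡ-+ (N C M) (f M) (g M)))
        (∑<-+ (suc N) (λ M → (N C M) * f M) (λ M → (N C M) * g M))

binomialTransform-*ˡ : ∀ N c f → binomialTransform (λ M → c * f M) N ≡ c * binomialTransform f N
binomialTransform-*ˡ N c f =
  trans (∑<-cong (suc N) (λ M _ → *-left-comm (N C M) c (f M)))
        (∑<-*ˡ (suc N) c (λ M → (N C M) * f M))

binomialTransform-∑< : ∀ N L (F : ℕ → ℕ → ℕ) →
  binomialTransform (λ M → ∑[ k < L ] F k M) N ≡ ∑[ k < L ] binomialTransform (F k) N
binomialTransform-∑< N L F =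
  trans (∑<-cong (suc N) (λ M _ → sym (∑<-*ˡ L (N C M) (λ k → F k M))))
        (∑<-comm (suc N) L (λ M k → (N C M) * F k M))

binomialTransform-suc : ∀ N f →
  binomialTransform f (suc N) ≡ binomialTransform f N + binomialTransform (f ∘ suc) N
binomialTransform-suc N f = begin
  binomialTransform f (suc N)
    ≡⟨ cong (f 0 + 0 +_) (trans (∑<-cong (suc N) pascal)
                                  (∑<-+ (suc N) (λ M → (N C M) * f (suc M)) (λ M → (N C suc M) * f (suc M)))) ⟩
  f 0 + 0 + (binomialTransform (f ∘ suc) N + ∑[ M < suc N ] ((N C suc M) * f (suc M)))
    ≡⟨ +-assoc-comm (f 0 + 0) _ _ ⟩
  ∑[ M < suc (suc N) ] ((N C M) * f M) + binomialTransform (f ∘ suc) N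
    ≡⟨ cong (_+ binomialTransform (f ∘ suc) N)
            (∑<-extend (λ M → (N C M) * f M) (n≤1+n (suc N)) (λ M N<M → cong (_* f M) (k>n⇒nCk≡0 N<M))) ⟩
  binomialTransform f N + binomialTransform (f ∘ suc) N ∎
  where
  pascal : ∀ M → M < suc N → (suc N C suc M) * f (suc M) ≡ (N C M) * f (suc M) + (N C suc M) * f (suc M)
  pascal M _ = trans (cong (_* f (suc M)) (sym (nCk+nC[k+1]≡[n+1]C[k+1] N M)))
                     (*-distribʳ-+ (f (suc M)) (N C M) (N C suc M))

stirling₂ : ℕ → ℕ → ℕ
stirling₂ zero    zero    = 1
stirling₂ zero    (suc k) = 0
stirling₂ (suc n) zero    = 0
stirling₂ (suc n) (suc k) = suc k * stirling₂ n (suc k) + stirling₂ n k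

stirling₂-zero : ∀ {n k} → n < k → stirling₂ n k ≡ 0
stirling₂-zero {zero}  {suc k} _         = refl
stirling₂-zero {suc n} {suc k} (s<s n<k) =
  trans (cong₂ (λ a b → suc k * a + b) (stirling₂-zero (m<n⇒m<1+n n<k)) (stirling₂-zero n<k))
        (trans (+-identityʳ _) (*-zeroʳ (suc k)))

stirling₂-diag : ∀ n → stirling₂ n n ≡ 1
stirling₂-diag zero    = refl
stirling₂-diag (suc n) =
  trans (cong₂ (λ a b → suc n * a + b) (stirling₂-zero (n<1+n n)) (stirling₂-diag n))
        (cong (_+ 1) (*-zeroʳ (suc n)))

binomialTransform-stirling₂ : ∀ N k →
  binomialTransform (λ M → stirling₂ M k) N ≡ stirling₂ (suc N) (suc k)
binomialTransform-stirling₂ zero    zero    = refl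
binomialTransform-stirling₂ zero    (suc k) = sym (trans (+-identityʳ _) (*-zeroʳ (suc (suc k))))
binomialTransform-stirling₂ (suc N) zero    = begin
  binomialTransform (λ M → stirling₂ M 0) (suc N)
    ≡⟨ binomialTransform-suc N (λ M → stirling₂ M 0) ⟩
  binomialTransform (λ M → stirling₂ M 0) N + binomialTransform (λ _ → 0) N
    ≡⟨ cong₂ _+_ (binomialTransform-stirling₂ N 0) (∑<-zero (suc N) (λ M _ → *-zeroʳ (N C M))) ⟩
  stirling₂ (suc N) 1 + 0
    ≡⟨ cong (_+ 0) (sym (+-identityʳ _)) ⟩
  stirling₂ (suc (suc N)) 1 ∎
binomialTransform-stirling₂ (suc N) (suc k) = begin
  binomialTransform (λ M → stirling₂ M (suc k)) (suc N)
    ≡⟨ binomialTransform-suc N (λ M → stirling₂ M (suc k)) ⟩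
  binomialTransform (λ M → stirling₂ M (suc k)) N
    + binomialTransform (λ M → suc k * stirling₂ M (suc k) + stirling₂ M k) N
    ≡⟨ cong (binomialTransform (λ M → stirling₂ M (suc k)) N +_)
            (trans (binomialTransform-+ N (λ M → suc k * stirling₂ M (suc k)) (λ M → stirling₂ M k))
                   (cong (_+ binomialTransform (λ M → stirling₂ M k) N)
                         (binomialTransform-*ˡ N (suc k) (λ M → stirling₂ M (suc k))))) ⟩
  binomialTransform (λ M → stirling₂ M (suc k)) N
    + (suc k * binomialTransform (λ M → stirling₂ M (suc k)) N
       + binomialTransform (λ M → stirling₂ M k) N)
    ≡⟨ cong₂ (λ a b → a + (suc k * a + b))
             (binomialTransform-stirling₂ N (suc k)) (binomialTransform-stirling₂ N k) ⟩
  stirling₂ (suc N) (suc (suc k)) + (suc k * stirling₂ (suc N) (suc (suc k)) + stirling₂ (suc N) (suc k))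
    ≡⟨ +-assoc (stirling₂ (suc N) (suc (suc k))) _ _ ⟨
  stirling₂ (suc (suc N)) (suc (suc k)) ∎

bell : ℕ → ℕ
bell n = ∑[ k < suc n ] stirling₂ n k

binomialTransform-bell : ∀ N → binomialTransform bell N ≡ bell (suc N)
binomialTransform-bell N = begin
  binomialTransform bell N
    ≡⟨ binomialTransform-cong N (λ M M≤N → sym (∑<-extend (stirling₂ M) (s≤s M≤N) (λ _ → stirling₂-zero))) ⟩
  binomialTransform (λ M → ∑[ k < suc N ] stirling₂ M k) N
    ≡⟨ binomialTransform-∑< N (suc N) (λ k M → stirling₂ M k) ⟩
  ∑[ k < suc N ] binomialTransform (λ M → stirling₂ M k) N
    ≡⟨ ∑<-cong (suc N) (λ k _ → binomialTransform-stirling₂ N k) ⟩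
  bell (suc N) ∎

∑<-stirling₂-extend : ∀ {n L} (f : ℕ → ℕ) → n < L →
  ∑[ k < L ] (f k * stirling₂ n k) ≡ ∑[ k < suc n ] (f k * stirling₂ n k)
∑<-stirling₂-extend {n} f n<L =
  ∑<-extend (λ k → f k * stirling₂ n k) n<L
            (λ k n<k → trans (cong (f k *_) (stirling₂-zero n<k)) (*-zeroʳ (f k)))

weightedStirling : ℕ → ℕ
weightedStirling n = ∑[ k < suc n ] (k * stirling₂ n k)

weightedStirling⁺ : ℕ → ℕ
weightedStirling⁺ n = ∑[ k < suc n ] (k * stirling₂ n (suc k))

bell-suc : ∀ n → bell (suc n) ≡ weightedStirling n + bell n
bell-suc n = begin
  bell (suc n)
    ≡⟨ ∑<-+ (suc n) (λ k → suc k * stirling₂ n (suc k)) (stirling₂ n) ⟩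
  ∑[ k < suc (suc n) ] (k * stirling₂ n k) + bell n
    ≡⟨ cong (_+ bell n) (∑<-stirling₂-extend {n} (λ k → k) (m<n⇒m<1+n (n<1+n n))) ⟩
  weightedStirling n + bell n ∎

binomialTransform-weightedStirling : ∀ m → binomialTransform weightedStirling m ≡ weightedStirling⁺ (suc m)
binomialTransform-weightedStirling m = begin
  binomialTransform weightedStirling m
    ≡⟨ binomialTransform-cong m (λ M M≤m → sym (∑<-stirling₂-extend {M} (λ k → k) (s≤s M≤m))) ⟩
  binomialTransform (λ M → ∑[ k < suc m ] (k * stirling₂ M k)) m
    ≡⟨ binomialTransform-∑< m (suc m) (λ k M → k * stirling₂ M k) ⟩
  ∑[ k < suc m ] binomialTransform (λ M → k * stirling₂ M k) m
    ≡⟨ ∑<-cong (suc m) (λ k _ → trans (binomialTransform-*ˡ m k (λ M → stirling₂ M k))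
                                       (cong (k *_) (binomialTransform-stirling₂ m k))) ⟩
  ∑[ k < suc m ] (k * stirling₂ (suc m) (suc k))
    ≡⟨ ∑<-extend (λ k → k * stirling₂ (suc m) (suc k)) (n≤1+n (suc m))
                 (λ k m<k → trans (cong (k *_) (stirling₂-zero (s<s m<k))) (*-zeroʳ k)) ⟨
  weightedStirling⁺ (suc m) ∎

-- stirlingConv c m N = [x^N] x/(1 - c x) · Σⱼ S(j,m) xʲ
stirlingConv : ℕ → ℕ → ℕ → ℕ
stirlingConv c m zero    = 0
stirlingConv c m (suc N) = stirling₂ N m + c * stirlingConv c m N

stirlingConv-zero : ∀ c {m N} → N ≤ m → stirlingConv c m N ≡ 0
stirlingConv-zero c {N = zero}  _   = refl
stirlingConv-zero c {N = suc N} N<m =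
  trans (cong₂ (λ a b → a + c * b) (stirling₂-zero N<m) (stirlingConv-zero c (<⇒≤ N<m))) (*-zeroʳ c)

binomialTransform-stirlingConv : ∀ N c m →
  binomialTransform (stirlingConv c m) N ≡ stirlingConv (suc c) (suc m) (suc N)
binomialTransform-stirlingConv zero    c m = sym (*-zeroʳ (suc c))
binomialTransform-stirlingConv (suc N) c m = begin
  binomialTransform Q (suc N)
    ≡⟨ binomialTransform-suc N Q ⟩
  binomialTransform Q N + binomialTransform (λ M → stirling₂ M m + c * Q M) N
    ≡⟨ cong (binomialTransform Q N +_)
            (trans (binomialTransform-+ N (λ M → stirling₂ M m) (λ M → c * Q M))
                   (cong₂ _+_ (binomialTransform-stirling₂ N m) (binomialTransform-*ˡ N c Q))) ⟩
  binomialTransform Q N + (stirling₂ (suc N) (suc m) + c * binomialTransform Q N)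
    ≡⟨ cong (λ q → q + (stirling₂ (suc N) (suc m) + c * q)) (binomialTransform-stirlingConv N c m) ⟩
  Q′ (suc N) + (stirling₂ (suc N) (suc m) + c * Q′ (suc N))
    ≡⟨ +-left-comm (Q′ (suc N)) (stirling₂ (suc N) (suc m)) (c * Q′ (suc N)) ⟩
  Q′ (suc (suc N)) ∎
  where
  Q  = stirlingConv c m
  Q′ = stirlingConv (suc c) (suc m)

-- Coefficients of the right-hand side

⊛-∑< : ∀ f g N → (f ⊛ g) N ≡ ∑[ i < suc N ] (f i * g (N ∸ i))
⊛-∑< f g N = sumBy-upTo (λ i → f i * g (N ∸ i)) (suc N)

mono-diag : ∀ c d → mono c d d ≡ c
mono-diag c d with d ≟ d
... | yes _  = refl
... | no d≢d = ⊥-elim (d≢d refl)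

mono-off : ∀ c d {i} → i ≢ d → mono c d i ≡ 0
mono-off c d {i} i≢d with i ≟ d
... | yes i≡d = ⊥-elim (i≢d i≡d)
... | no _    = refl

mono-⊛ : ∀ c d f {N} → d ≤ N → (mono c d ⊛ f) N ≡ c * f (N ∸ d)
mono-⊛ c d f {N} d≤N = begin
  (mono c d ⊛ f) N                              ≡⟨ ⊛-∑< (mono c d) f N ⟩
  ∑[ i < suc N ] (mono c d i * f (N ∸ i))
    ≡⟨ ∑<-single (λ i → mono c d i * f (N ∸ i)) (s≤s d≤N) (λ i i≢d → cong (_* f (N ∸ i)) (mono-off c d i≢d)) ⟩
  mono c d d * f (N ∸ d)                        ≡⟨ cong (_* f (N ∸ d)) (mono-diag c d) ⟩
  c * f (N ∸ d)                                 ∎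

mono-⊛-< : ∀ c d f {N} → N < d → (mono c d ⊛ f) N ≡ 0
mono-⊛-< c d f {N} N<d = trans (⊛-∑< (mono c d) f N) (∑<-zero (suc N) vanish)
  where
  vanish : ∀ i → i < suc N → mono c d i * f (N ∸ i) ≡ 0
  vanish i i≤N = cong (_* f (N ∸ i)) (mono-off c d (λ i≡d → <⇒≱ N<d (subst (_≤ N) i≡d (s≤s⁻¹ i≤N))))

⊛-identityˡ : ∀ f N → (mono 1 0 ⊛ f) N ≡ f N
⊛-identityˡ f N = trans (mono-⊛ 1 0 f z≤n) (*-identityˡ (f N))

⊛-rec : ∀ {F e : PS} c H → F 0 ≡ 0 → (∀ i → F (suc i) ≡ c * F i + e i) →
        ∀ N → (F ⊛ H) (suc N) ≡ c * (F ⊛ H) N + (e ⊛ H) N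
⊛-rec {F} {e} c H F0≡0 F-rec N = begin
  (F ⊛ H) (suc N)
    ≡⟨ ⊛-∑< F H (suc N) ⟩
  F 0 * H (suc N) + ∑[ i < suc N ] (F (suc i) * H (N ∸ i))
    ≡⟨ cong₂ _+_ (cong (_* H (suc N)) F0≡0) (∑<-cong (suc N) (λ i _ → step i)) ⟩
  ∑[ i < suc N ] (c * (F i * H (N ∸ i)) + e i * H (N ∸ i))
    ≡⟨ ∑<-+ (suc N) (λ i → c * (F i * H (N ∸ i))) (λ i → e i * H (N ∸ i)) ⟩
  ∑[ i < suc N ] (c * (F i * H (N ∸ i))) + ∑[ i < suc N ] (e i * H (N ∸ i))
    ≡⟨ cong₂ _+_ (∑<-*ˡ (suc N) c (λ i → F i * H (N ∸ i))) refl ⟩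
  c * ∑[ i < suc N ] (F i * H (N ∸ i)) + ∑[ i < suc N ] (e i * H (N ∸ i))
    ≡⟨ cong₂ (λ a b → c * a + b) (⊛-∑< F H N) (⊛-∑< e H N) ⟨
  c * (F ⊛ H) N + (e ⊛ H) N ∎
  where
  step : ∀ i → F (suc i) * H (N ∸ i) ≡ c * (F i * H (N ∸ i)) + e i * H (N ∸ i)
  step i = begin
    F (suc i) * H (N ∸ i)                          ≡⟨ cong (_* H (N ∸ i)) (F-rec i) ⟩
    (c * F i + e i) * H (N ∸ i)                    ≡⟨ *-distribʳ-+ (H (N ∸ i)) (c * F i) (e i) ⟩
    c * F i * H (N ∸ i) + e i * H (N ∸ i)          ≡⟨ cong (_+ e i * H (N ∸ i)) (*-assoc c (F i) (H (N ∸ i))) ⟩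
    c * (F i * H (N ∸ i)) + e i * H (N ∸ i)        ∎

⊛-inv1m-suc : ∀ H c N → (H ⊛ inv1m c) (suc N) ≡ H (suc N) + c * (H ⊛ inv1m c) N
⊛-inv1m-suc H c N = begin
  (H ⊛ inv1m c) (suc N)
    ≡⟨ ⊛-∑< H (inv1m c) (suc N) ⟩
  ∑[ i < suc (suc N) ] (H i * c ^ (suc N ∸ i))
    ≡⟨ ∑<-suc (suc N) (λ i → H i * c ^ (suc N ∸ i)) ⟩
  ∑[ i < suc N ] (H i * c ^ (suc N ∸ i)) + H (suc N) * c ^ (suc N ∸ suc N)
    ≡⟨ cong₂ _+_ (∑<-cong (suc N) (λ i i≤N → shift i (s≤s⁻¹ i≤N))) last ⟩
  ∑[ i < suc N ] (c * (H i * c ^ (N ∸ i))) + H (suc N)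
    ≡⟨ +-comm _ (H (suc N)) ⟩
  H (suc N) + ∑[ i < suc N ] (c * (H i * c ^ (N ∸ i)))
    ≡⟨ cong (H (suc N) +_) (trans (∑<-*ˡ (suc N) c (λ i → H i * c ^ (N ∸ i)))
                                  (cong (c *_) (sym (⊛-∑< H (inv1m c) N)))) ⟩
  H (suc N) + c * (H ⊛ inv1m c) N ∎
  where
  shift : ∀ i → i ≤ N → H i * c ^ (suc N ∸ i) ≡ c * (H i * c ^ (N ∸ i))
  shift i i≤N = trans (cong (λ e → H i * c ^ e) (+-∸-assoc 1 i≤N)) (*-left-comm (H i) c (c ^ (N ∸ i)))
  last : H (suc N) * c ^ (suc N ∸ suc N) ≡ H (suc N)
  last = trans (cong (λ e → H (suc N) * c ^ e) (n∸n≡0 N)) (*-identityʳ (H (suc N)))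

invProd-zero : ∀ K → invProd K 0 ≡ 1
invProd-zero zero    = refl
invProd-zero (suc K) = trans (+-identityʳ _) (trans (*-identityʳ (invProd K 0)) (invProd-zero K))

invProd-stirling₂ : ∀ K N → invProd K N ≡ stirling₂ (N + K) K
invProd-stirling₂ zero    zero    = refl
invProd-stirling₂ zero    (suc N) = refl
invProd-stirling₂ (suc K) zero    = trans (invProd-zero (suc K)) (sym (stirling₂-diag (suc K)))
invProd-stirling₂ (suc K) (suc N) = begin
  invProd (suc K) (suc N)
    ≡⟨ ⊛-inv1m-suc (invProd K) (suc K) N ⟩
  invProd K (suc N) + suc K * invProd (suc K) N
    ≡⟨ cong₂ (λ a b → a + suc K * b) (invProd-stirling₂ K (suc N)) (invProd-stirling₂ (suc K) N) ⟩
  stirling₂ (suc N + K) K + suc K * stirling₂ (N + suc K) (suc K)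
    ≡⟨ +-comm (stirling₂ (suc N + K) K) _ ⟩
  suc K * stirling₂ (N + suc K) (suc K) + stirling₂ (suc N + K) K
    ≡⟨ cong (λ n → suc K * stirling₂ (N + suc K) (suc K) + stirling₂ n K) (sym (+-suc N K)) ⟩
  stirling₂ (suc N + suc K) (suc K) ∎

mono-⊛-invProd : ∀ k m N → (mono k m ⊛ invProd m) N ≡ k * stirling₂ N m
mono-⊛-invProd k m N with m ≤? N
... | yes m≤N = begin
  (mono k m ⊛ invProd m) N         ≡⟨ mono-⊛ k m (invProd m) m≤N ⟩
  k * invProd m (N ∸ m)            ≡⟨ cong (k *_) (invProd-stirling₂ m (N ∸ m)) ⟩
  k * stirling₂ (N ∸ m + m) m      ≡⟨ cong (λ n → k * stirling₂ n m) (m∸n+n≡m m≤N) ⟩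
  k * stirling₂ N m                ∎
... | no m≰N = begin
  (mono k m ⊛ invProd m) N         ≡⟨ mono-⊛-< k m (invProd m) (≰⇒> m≰N) ⟩
  0                                ≡⟨ *-zeroʳ k ⟨
  k * 0                            ≡⟨ cong (k *_) (stirling₂-zero (≰⇒> m≰N)) ⟨
  k * stirling₂ N m                ∎

termCoeff : ℕ → ℕ → ℕ → ℕ
termCoeff n k N = k * stirlingConv n (k + suc n) N

term-coeff : ∀ n k N → term (suc n) k N ≡ termCoeff n k N
term-coeff n k = F⊛invProd
  where
  m = k + suc n
  D F : PS
  D = mono 1 1 ⊛ inv1m n
  F = D ⊛ mono k m

  D-suc : ∀ j → D (suc j) ≡ n ^ j
  D-suc j = trans (mono-⊛ 1 1 (inv1m n) {suc j} (s≤s z≤n)) (*-identityˡ (n ^ j))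

  D-rec : ∀ i → D (suc i) ≡ n * D i + mono 1 0 i
  D-rec zero    = trans (D-suc 0) (sym (cong (_+ 1) (*-zeroʳ n)))
  D-rec (suc j) = trans (D-suc (suc j)) (sym (trans (+-identityʳ _) (cong (n *_) (D-suc j))))

  F-rec : ∀ i → F (suc i) ≡ n * F i + mono k m i
  F-rec i = trans (⊛-rec n (mono k m) refl D-rec i) (cong (n * F i +_) (⊛-identityˡ (mono k m) i))

  F⊛invProd : ∀ N → (F ⊛ invProd m) N ≡ k * stirlingConv n m N
  F⊛invProd zero    = sym (*-zeroʳ k)
  F⊛invProd (suc N) = begin
    (F ⊛ invProd m) (suc N)
      ≡⟨ ⊛-rec n (invProd m) refl F-rec N ⟩
    n * (F ⊛ invProd m) N + (mono k m ⊛ invProd m) N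
      ≡⟨ cong₂ (λ a b → n * a + b) (F⊛invProd N) (mono-⊛-invProd k m N) ⟩
    n * (k * stirlingConv n m N) + k * stirling₂ N m
      ≡⟨ +-comm _ (k * stirling₂ N m) ⟩
    k * stirling₂ N m + n * (k * stirlingConv n m N)
      ≡⟨ cong (k * stirling₂ N m +_) (*-left-comm n k (stirlingConv n m N)) ⟩
    k * stirling₂ N m + k * (n * stirlingConv n m N)
      ≡⟨ *-distribˡ-+ k (stirling₂ N m) (n * stirlingConv n m N) ⟨
    k * stirlingConv n m (suc N) ∎

termCoeff-zero : ∀ {n k N} → N ≤ k + suc n → termCoeff n k N ≡ 0
termCoeff-zero {n} {k} N≤m = trans (cong (k *_) (stirlingConv-zero n N≤m)) (*-zeroʳ k)

binomialTransform-termCoeff : ∀ n k N → binomialTransform (termCoeff n k) N ≡ termCoeff (suc n) k (suc N)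
binomialTransform-termCoeff n k N = begin
  binomialTransform (λ M → k * stirlingConv n (k + suc n) M) N
    ≡⟨ binomialTransform-*ˡ N k (stirlingConv n (k + suc n)) ⟩
  k * binomialTransform (stirlingConv n (k + suc n)) N
    ≡⟨ cong (k *_) (binomialTransform-stirlingConv N n (k + suc n)) ⟩
  k * stirlingConv (suc n) (suc (k + suc n)) (suc N)
    ≡⟨ cong (λ m → k * stirlingConv (suc n) m (suc N)) (+-suc k (suc n)) ⟨
  termCoeff (suc n) k (suc N) ∎

rhs-∑< : ∀ N → rhs N ≡ ∑[ n < N ] ∑[ k < suc N ] termCoeff n k N
rhs-∑< N = begin
  rhs N
    ≡⟨ sumBy-map (λ n → sumBy (λ k → term n k N) (upTo (suc N))) suc (upTo N) ⟩
  sumBy (λ n → sumBy (λ k → term (suc n) k N) (upTo (suc N))) (upTo N)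
    ≡⟨ sumBy-upTo _ N ⟩
  ∑[ n < N ] sumBy (λ k → term (suc n) k N) (upTo (suc N))
    ≡⟨ ∑<-cong N (λ n _ → trans (sumBy-upTo _ (suc N)) (∑<-cong (suc N) (λ k _ → term-coeff n k N))) ⟩
  ∑[ n < N ] ∑[ k < suc N ] termCoeff n k N ∎

rhsBox : ℕ → ℕ → ℕ
rhsBox L N = ∑[ n < L ] ∑[ k < L ] termCoeff n k N

rhs-box : ∀ {N L} → N < L → rhs N ≡ rhsBox L N
rhs-box {N} {L} N<L = begin
  rhs N
    ≡⟨ rhs-∑< N ⟩
  ∑[ n < N ] ∑[ k < suc N ] termCoeff n k N
    ≡⟨ ∑<-cong N (λ n _ → ∑<-extend (λ k → termCoeff n k N) N<L
                              (λ k N<k → termCoeff-zero (≤-trans (<⇒≤ N<k) (m≤m+n k (suc n))))) ⟨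
  ∑[ n < N ] ∑[ k < L ] termCoeff n k N
    ≡⟨ ∑<-extend (λ n → ∑[ k < L ] termCoeff n k N) (<⇒≤ N<L)
                 (λ n N≤n → ∑<-zero L (λ k _ → termCoeff-zero (m≤n⇒m≤o+n k (m≤n⇒m≤1+n N≤n)))) ⟨
  rhsBox L N ∎

rhs-suc : ∀ m → rhs (suc m) ≡ binomialTransform rhs m + weightedStirling⁺ m
rhs-suc m = begin
  rhs (suc m)
    ≡⟨ rhs-box {suc m} ≤-refl ⟩
  ∑[ k < L ] termCoeff 0 k (suc m) + ∑[ n < suc m ] ∑[ k < L ] termCoeff (suc n) k (suc m)
    ≡⟨ +-comm (∑[ k < L ] termCoeff 0 k (suc m)) _ ⟩
  ∑[ n < suc m ] ∑[ k < L ] termCoeff (suc n) k (suc m) + ∑[ k < L ] termCoeff 0 k (suc m)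
    ≡⟨ cong₂ _+_ later-rows first-row ⟩
  binomialTransform rhs m + weightedStirling⁺ m ∎
  where
  L = suc (suc m)
  first-row : ∑[ k < L ] termCoeff 0 k (suc m) ≡ weightedStirling⁺ m
  first-row = begin
    ∑[ k < L ] termCoeff 0 k (suc m)
      ≡⟨ ∑<-cong L (λ k _ → cong (k *_) (trans (+-identityʳ _) (cong (stirling₂ m) (+-comm k 1)))) ⟩
    ∑[ k < L ] (k * stirling₂ m (suc k))
      ≡⟨ ∑<-extend (λ k → k * stirling₂ m (suc k)) (n≤1+n (suc m))
                   (λ k m<k → trans (cong (k *_) (stirling₂-zero (m<n⇒m<1+n m<k))) (*-zeroʳ k)) ⟩
    weightedStirling⁺ m ∎
  later-rows : ∑[ n < suc m ] ∑[ k < L ] termCoeff (suc n) k (suc m) ≡ binomialTransform rhs m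
  later-rows = begin
    ∑[ n < suc m ] ∑[ k < L ] termCoeff (suc n) k (suc m)
      ≡⟨ ∑<-extend (λ n → ∑[ k < L ] termCoeff (suc n) k (suc m)) (n≤1+n (suc m))
                   (λ n m<n → ∑<-zero L (λ k _ → termCoeff-zero (m≤n⇒m≤o+n k (m≤n⇒m≤1+n (s≤s (<⇒≤ m<n)))))) ⟨
    ∑[ n < L ] ∑[ k < L ] termCoeff (suc n) k (suc m)
      ≡⟨ ∑<-cong L (λ n _ → ∑<-cong L (λ k _ → binomialTransform-termCoeff n k m)) ⟨
    ∑[ n < L ] ∑[ k < L ] binomialTransform (termCoeff n k) m
      ≡⟨ ∑<-cong L (λ n _ → binomialTransform-∑< m L (λ k → termCoeff n k)) ⟨
    ∑[ n < L ] binomialTransform (λ M → ∑[ k < L ] termCoeff n k M) m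
      ≡⟨ binomialTransform-∑< m L (λ n M → ∑[ k < L ] termCoeff n k M) ⟨
    binomialTransform (rhsBox L) m
      ≡⟨ binomialTransform-cong m (λ M M≤m → rhs-box (m<n⇒m<1+n (s≤s M≤m))) ⟨
    binomialTransform rhs m ∎

-- Permutations by their first letter

<ᵇ-true : ∀ {m n} → m < n → (m <ᵇ n) ≡ true
<ᵇ-true {m} {n} = dec-true (m <? n)

<ᵇ-false : ∀ {m n} → n ≤ m → (m <ᵇ n) ≡ false
<ᵇ-false {m} {n} n≤m = dec-false (m <? n) (≤⇒≯ n≤m)

skip : ℕ → ℕ → ℕ
skip a x = if x <ᵇ a then x else suc x

_◃_ : ℕ → List ℕ → List ℕ
a ◃ π = a ∷ map (skip a) π

skip-suc : ∀ a x → skip (suc a) (suc x) ≡ suc (skip a x)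
skip-suc a x with x <ᵇ a
... | true  = refl
... | false = refl

skip-≢ : ∀ a x → a ≢ skip a x
skip-≢ a x with x <ᵇ a | <ᵇ-reflects-< x a
... | true  | ofʸ x<a = >⇒≢ x<a
... | false | ofⁿ x≮a = λ a≡1+x → x≮a (subst (x <_) (sym a≡1+x) (n<1+n x))

skip-injective : ∀ a {x y} → skip a x ≡ skip a y → x ≡ y
skip-injective a {x} {y} eq with x <ᵇ a | <ᵇ-reflects-< x a | y <ᵇ a | <ᵇ-reflects-< y a
... | true  | _        | true  | _        = eq
... | true  | ofʸ x<a  | false | ofⁿ y≮a  = ⊥-elim (y≮a (<-trans (n<1+n y) (subst (_< a) eq x<a)))
... | false | ofⁿ x≮a  | true  | ofʸ y<a  = ⊥-elim (x≮a (<-trans (n<1+n x) (subst (_< a) (sym eq) y<a)))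
... | false | _        | false | _        = suc-injective eq

unique-◃ : ∀ a π → does (unique? (a ◃ π)) ≡ does (unique? π)
unique-◃ a π = does-⇔ (mk⇔ (λ { (_ ∷ u) → map⁻ u }) (λ u → fresh ∷ map⁺ (skip-injective a) u))
                      (unique? (a ◃ π)) (unique? π)
  where
  fresh : All (a ≢_) (map (skip a) π)
  fresh = All.map⁺ (All.universal (skip-≢ a) π)

unique-∈ : ∀ {a w} → a ∈ w → does (unique? (a ∷ w)) ≡ false
unique-∈ {a} {w} a∈w = dec-false (unique? (a ∷ w)) (λ { (a∉w ∷ _) → All.lookup a∉w a∈w refl })

without : ℕ → List ℕ → List ℕ
without a = filter (λ x → ¬? (x ≟ a))

without-map-suc : ∀ a xs → without (suc a) (map suc xs) ≡ map suc (without a xs)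
without-map-suc a []       = refl
without-map-suc a (x ∷ xs) with x ≡ᵇ a
... | true  = without-map-suc a xs
... | false = cong (suc x ∷_) (without-map-suc a xs)

map-suc-skip : ∀ a xs → map suc (map (skip a) xs) ≡ map (skip (suc a)) (map suc xs)
map-suc-skip a xs = begin
  map suc (map (skip a) xs)           ≡⟨ map-∘ xs ⟨
  map (suc ∘ skip a) xs               ≡⟨ map-cong (λ x → sym (skip-suc a x)) xs ⟩
  map (skip (suc a) ∘ suc) xs         ≡⟨ map-∘ xs ⟩
  map (skip (suc a)) (map suc xs)     ∎

without-zero-map-suc : ∀ xs → without 0 (map suc xs) ≡ map suc xs
without-zero-map-suc []       = refl
without-zero-map-suc (x ∷ xs) = cong (suc x ∷_) (without-zero-map-suc xs)

without-upTo : ∀ {a n} → a ≤ n → without a (upTo (suc n)) ≡ map (skip a) (upTo n)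
without-upTo {zero}  {n}     _         =
  trans (cong (without 0) (sym (map-upTo suc n))) (without-zero-map-suc (upTo n))
without-upTo {suc a} {suc n} (s≤s a≤n) = cong (0 ∷_) $ begin
  without (suc a) (applyUpTo suc (suc n))        ≡⟨ cong (without (suc a)) (map-upTo suc (suc n)) ⟨
  without (suc a) (map suc (upTo (suc n)))       ≡⟨ without-map-suc a (upTo (suc n)) ⟩
  map suc (without a (upTo (suc n)))             ≡⟨ cong (map suc) (without-upTo a≤n) ⟩
  map suc (map (skip a) (upTo n))                ≡⟨ map-suc-skip a (upTo n) ⟩
  map (skip (suc a)) (map suc (upTo n))          ≡⟨ cong (map (skip (suc a))) (map-upTo suc n) ⟩
  map (skip (suc a)) (applyUpTo suc n)           ∎

without-[] : ∀ {a n} → a ≤ n → without (suc a) [ suc n ] ≡ map (skip (suc a)) [ n ]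
without-[] {a} {n} a≤n = begin
  without (suc a) (map suc (upTo (suc n)))       ≡⟨ without-map-suc a (upTo (suc n)) ⟩
  map suc (without a (upTo (suc n)))             ≡⟨ cong (map suc) (without-upTo a≤n) ⟩
  map suc (map (skip a) (upTo n))                ≡⟨ map-suc-skip a (upTo n) ⟩
  map (skip (suc a)) [ n ]                       ∎

sumBy-words-suc : ∀ n L g → sumBy g (words (suc n) L) ≡ sumBy (λ b → sumBy (g ∘ (b ∷_)) (words n L)) L
sumBy-words-suc n L g = trans (sumBy-concatMap g (λ b → map (b ∷_) (words n L)) L)
                              (sumBy-cong (λ b → sumBy-map g (b ∷_) (words n L)) L)

sumBy-words-map : ∀ n h L g → sumBy g (words n (map h L)) ≡ sumBy (g ∘ map h) (words n L)
sumBy-words-map zero    h L g = refl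
sumBy-words-map (suc n) h L g = begin
  sumBy g (words (suc n) (map h L))
    ≡⟨ sumBy-words-suc n (map h L) g ⟩
  sumBy (λ b → sumBy (g ∘ (b ∷_)) (words n (map h L))) (map h L)
    ≡⟨ sumBy-map _ h L ⟩
  sumBy (λ a → sumBy (g ∘ (h a ∷_)) (words n (map h L))) L
    ≡⟨ sumBy-cong (λ a → sumBy-words-map n h L (g ∘ (h a ∷_))) L ⟩
  sumBy (λ a → sumBy (g ∘ map h ∘ (a ∷_)) (words n L)) L
    ≡⟨ sumBy-words-suc n L (g ∘ map h) ⟨
  sumBy (g ∘ map h) (words (suc n) L) ∎

sumBy-without : ∀ a L F → F a ≡ 0 → sumBy F L ≡ sumBy F (without a L)
sumBy-without a []      F Fa≡0 = refl
sumBy-without a (x ∷ L) F Fa≡0 with x ≡ᵇ a | ≡ᵇ⇒≡ x a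
... | true  | x≡a = trans (cong (_+ sumBy F L) (trans (cong F (x≡a _)) Fa≡0)) (sumBy-without a L F Fa≡0)
... | false | _   = cong (F x +_) (sumBy-without a L F Fa≡0)

sumBy-words-without : ∀ n a L g → (∀ w → a ∈ w → g w ≡ 0) →
                      sumBy g (words n L) ≡ sumBy g (words n (without a L))
sumBy-words-without zero    a L g g≡0 = refl
sumBy-words-without (suc n) a L g g≡0 = begin
  sumBy g (words (suc n) L)
    ≡⟨ sumBy-words-suc n L g ⟩
  sumBy (λ b → sumBy (g ∘ (b ∷_)) (words n L)) L
    ≡⟨ sumBy-cong (λ b → sumBy-words-without n a L (g ∘ (b ∷_)) (λ w a∈w → g≡0 (b ∷ w) (there a∈w))) L ⟩
  sumBy (λ b → sumBy (g ∘ (b ∷_)) (words n L′)) L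
    ≡⟨ sumBy-without a L _ (sumBy-zero (λ w → g≡0 (a ∷ w) (here refl)) (words n L′)) ⟩
  sumBy (λ b → sumBy (g ∘ (b ∷_)) (words n L′)) L′
    ≡⟨ sumBy-words-suc n L′ g ⟨
  sumBy g (words (suc n) L′) ∎
  where
  L′ = without a L

sumPerms : ℕ → (List ℕ → ℕ) → ℕ
sumPerms n f = sumBy f (perms n)

sumPerms-cong : ∀ n {f g} → (∀ π → f π ≡ g π) → sumPerms n f ≡ sumPerms n g
sumPerms-cong n f≗g = sumBy-cong f≗g (perms n)

sumPerms-+ : ∀ n f g → sumPerms n (λ π → f π + g π) ≡ sumPerms n f + sumPerms n g
sumPerms-+ n f g = sumBy-+ f g (perms n)

sumPerms-*ˡ : ∀ n c f → sumPerms n (λ π → c * f π) ≡ c * sumPerms n f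
sumPerms-*ˡ n c f = sumBy-*ˡ c f (perms n)

onUnique : (List ℕ → ℕ) → List ℕ → ℕ
onUnique f w = if does (unique? w) then f w else 0

sumPerms-words : ∀ n f → sumPerms n f ≡ sumBy (onUnique f) (words n [ n ])
sumPerms-words n f = sumBy-filter unique? f (words n [ n ])

sumPerms-suc : ∀ n f → sumPerms (suc n) f ≡ ∑[ i < suc n ] sumPerms n (f ∘ (suc i ◃_))
sumPerms-suc n f = begin
  sumPerms (suc n) f
    ≡⟨ sumPerms-words (suc n) f ⟩
  sumBy (onUnique f) (words (suc n) [ suc n ])
    ≡⟨ sumBy-words-suc n [ suc n ] (onUnique f) ⟩
  sumBy (λ b → sumBy (onUnique f ∘ (b ∷_)) (words n [ suc n ])) (map suc (upTo (suc n)))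
    ≡⟨ sumBy-map _ suc (upTo (suc n)) ⟩
  sumBy (λ i → sumBy (onUnique f ∘ (suc i ∷_)) (words n [ suc n ])) (upTo (suc n))
    ≡⟨ sumBy-upTo _ (suc n) ⟩
  ∑[ i < suc n ] sumBy (onUnique f ∘ (suc i ∷_)) (words n [ suc n ])
    ≡⟨ ∑<-cong (suc n) first-letter ⟩
  ∑[ i < suc n ] sumPerms n (f ∘ (suc i ◃_)) ∎
  where
  first-letter : ∀ i → i < suc n →
                 sumBy (onUnique f ∘ (suc i ∷_)) (words n [ suc n ]) ≡ sumPerms n (f ∘ (suc i ◃_))
  first-letter i i≤n = begin
    sumBy (onUnique f ∘ (suc i ∷_)) (words n [ suc n ])
      ≡⟨ sumBy-words-without n (suc i) [ suc n ] _
           (λ w i∈w → cong (λ b → if b then f (suc i ∷ w) else 0) (unique-∈ i∈w)) ⟩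
    sumBy (onUnique f ∘ (suc i ∷_)) (words n (without (suc i) [ suc n ]))
      ≡⟨ cong (λ L → sumBy (onUnique f ∘ (suc i ∷_)) (words n L)) (without-[] (s≤s⁻¹ i≤n)) ⟩
    sumBy (onUnique f ∘ (suc i ∷_)) (words n (map (skip (suc i)) [ n ]))
      ≡⟨ sumBy-words-map n (skip (suc i)) [ n ] _ ⟩
    sumBy (onUnique f ∘ (suc i ◃_)) (words n [ n ])
      ≡⟨ sumBy-cong (λ π → cong (λ b → if b then f (suc i ◃ π) else 0) (unique-◃ (suc i) π)) (words n [ n ]) ⟩
    sumBy (onUnique (f ∘ (suc i ◃_))) (words n [ n ])
      ≡⟨ sumPerms-words n (f ∘ (suc i ◃_)) ⟨
    sumPerms n (f ∘ (suc i ◃_)) ∎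

data IsPerm : ℕ → List ℕ → Set where
  []      : IsPerm 0 []
  prepend : ∀ {n i π} → i ≤ n → IsPerm n π → IsPerm (suc n) (suc i ◃ π)

sumPerms-congᴾ : ∀ n {f g} → (∀ π → IsPerm n π → f π ≡ g π) → sumPerms n f ≡ sumPerms n g
sumPerms-congᴾ zero    f≗g = cong (_+ 0) (f≗g [] [])
sumPerms-congᴾ (suc n) {f} {g} f≗g = begin
  sumPerms (suc n) f                         ≡⟨ sumPerms-suc n f ⟩
  ∑[ i < suc n ] sumPerms n (f ∘ (suc i ◃_))
    ≡⟨ ∑<-cong (suc n) (λ i i≤n → sumPerms-congᴾ n (λ π π-perm → f≗g _ (prepend (s≤s⁻¹ i≤n) π-perm))) ⟩
  ∑[ i < suc n ] sumPerms n (g ∘ (suc i ◃_))  ≡⟨ sumPerms-suc n g ⟨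
  sumPerms (suc n) g                         ∎

-- Occurrences of 23-1

countBelow : ℕ → List ℕ → ℕ
countBelow a = sumBy (λ x → 𝟙 (x <ᵇ a))

occurrences′ : List ℕ → ℕ
occurrences′ []          = 0
occurrences′ (x ∷ [])    = 0
occurrences′ (x ∷ y ∷ r) = (if x <ᵇ y then countBelow x r else 0) + occurrences′ (y ∷ r)

countBelow-at : ∀ a r → ∑[ j < length r ] 𝟙 ((j <ᵇ length r) ∧ (at r j <ᵇ a)) ≡ countBelow a r
countBelow-at a []      = refl
countBelow-at a (x ∷ r) = cong (𝟙 (x <ᵇ a) +_) (countBelow-at a r)

∑<-first-row : ∀ a b r →
  ∑[ j < length r ] 𝟙 ((j <ᵇ length r) ∧ ((at r j <ᵇ a) ∧ (a <ᵇ b))) ≡ (if a <ᵇ b then countBelow a r else 0)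
∑<-first-row a b r with a <ᵇ b
... | true  = trans (∑<-cong (length r) (λ j _ → cong (λ c → 𝟙 ((j <ᵇ length r) ∧ c)) (∧-identityʳ _)))
                    (countBelow-at a r)
... | false = ∑<-zero (length r) (λ j _ → cong 𝟙 (trans (cong ((j <ᵇ length r) ∧_) (∧-zeroʳ _)) (∧-zeroʳ _)))

∑<-occ? : ∀ w → ∑[ i < length w ] ∑[ j < length w ] 𝟙 (does (occ? w (i , j))) ≡ occurrences′ w
∑<-occ? []          = refl
∑<-occ? (a ∷ [])    = refl
∑<-occ? (a ∷ b ∷ r) = cong₂ _+_ (∑<-first-row a b r) (∑<-occ? (b ∷ r))

occurrences≡occurrences′ : ∀ w → occurrences w ≡ occurrences′ w
occurrences≡occurrences′ w = begin
  occurrences w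
    ≡⟨ length-filter (occ? w) (cartesianProduct (upTo n) (upTo n)) ⟩
  sumBy (𝟙 ∘ does ∘ occ? w) (cartesianProduct (upTo n) (upTo n))
    ≡⟨ sumBy-cartesianProduct (𝟙 ∘ does ∘ occ? w) (upTo n) (upTo n) ⟩
  sumBy (λ i → sumBy (λ j → 𝟙 (does (occ? w (i , j)))) (upTo n)) (upTo n)
    ≡⟨ sumBy-cong (λ i → sumBy-upTo (λ j → 𝟙 (does (occ? w (i , j)))) n) (upTo n) ⟩
  sumBy (λ i → ∑[ j < n ] 𝟙 (does (occ? w (i , j)))) (upTo n)
    ≡⟨ sumBy-upTo _ n ⟩
  ∑[ i < n ] ∑[ j < n ] 𝟙 (does (occ? w (i , j)))
    ≡⟨ ∑<-occ? w ⟩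
  occurrences′ w ∎
  where
  n = length w

skip-<ᵇ : ∀ a x y → (skip a x <ᵇ skip a y) ≡ (x <ᵇ y)
skip-<ᵇ a x y with x <ᵇ a | <ᵇ-reflects-< x a | y <ᵇ a | <ᵇ-reflects-< y a
... | true  | _       | true  | _       = refl
... | true  | ofʸ x<a | false | ofⁿ y≮a = trans (<ᵇ-true (m<n⇒m<1+n x<y)) (sym (<ᵇ-true x<y))
  where x<y = <-≤-trans x<a (≮⇒≥ y≮a)
... | false | ofⁿ x≮a | true  | ofʸ y<a = trans (<ᵇ-false (m≤n⇒m≤1+n (<⇒≤ y<x))) (sym (<ᵇ-false (<⇒≤ y<x)))
  where y<x = <-≤-trans y<a (≮⇒≥ x≮a)
... | false | _       | false | _       = refl

skip-<ᵇ-low : ∀ {a c} x → c ≤ a → (skip a x <ᵇ c) ≡ (x <ᵇ c)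
skip-<ᵇ-low {a} {c} x c≤a with x <ᵇ a | <ᵇ-reflects-< x a
... | true  | _       = refl
... | false | ofⁿ x≮a = trans (<ᵇ-false (m≤n⇒m≤1+n c≤x)) (sym (<ᵇ-false c≤x))
  where c≤x = ≤-trans c≤a (≮⇒≥ x≮a)

skip-<ᵇ-high : ∀ {a c} x → a ≤ c → (skip a x <ᵇ suc c) ≡ (x <ᵇ c)
skip-<ᵇ-high {a} {c} x a≤c with x <ᵇ a | <ᵇ-reflects-< x a
... | true  | ofʸ x<a = trans (<ᵇ-true (m<n⇒m<1+n x<c)) (sym (<ᵇ-true x<c))
  where x<c = <-≤-trans x<a a≤c
... | false | _       = refl

countBelow-skip-low : ∀ {a c} r → c ≤ a → countBelow c (map (skip a) r) ≡ countBelow c r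
countBelow-skip-low r c≤a = trans (sumBy-map _ _ r) (sumBy-cong (λ x → cong 𝟙 (skip-<ᵇ-low x c≤a)) r)

countBelow-skip-high : ∀ {a c} r → a ≤ c → countBelow (suc c) (map (skip a) r) ≡ countBelow c r
countBelow-skip-high r a≤c = trans (sumBy-map _ _ r) (sumBy-cong (λ x → cong 𝟙 (skip-<ᵇ-high x a≤c)) r)

countBelow-skip : ∀ a x r → countBelow (skip a x) (map (skip a) r) ≡ countBelow x r
countBelow-skip a x r = trans (sumBy-map _ (skip a) r) (sumBy-cong (λ y → cong 𝟙 (skip-<ᵇ a y x)) r)

occurrences′-skip : ∀ a w → occurrences′ (map (skip a) w) ≡ occurrences′ w
occurrences′-skip a []          = refl
occurrences′-skip a (x ∷ [])    = refl
occurrences′-skip a (x ∷ y ∷ r) = cong₂ _+_ first-pair (occurrences′-skip a (y ∷ r))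
  where
  first-pair : (if skip a x <ᵇ skip a y then countBelow (skip a x) (map (skip a) r) else 0)
             ≡ (if x <ᵇ y then countBelow x r else 0)
  first-pair = cong₂ (λ b c → if b then c else 0) (skip-<ᵇ a x y) (countBelow-skip a x r)

countBelow-IsPerm : ∀ {n π c} → IsPerm n π → c ≤ suc n → countBelow c π ≡ c ∸ 1
countBelow-IsPerm {c = zero}        []  _               = refl
countBelow-IsPerm {c = suc zero}    []  _               = refl
countBelow-IsPerm {c = suc (suc c)} []  (s≤s ())
countBelow-IsPerm {c = c} (prepend {i = i} {π} i≤n π-perm) c≤1+n with c ≤? suc i
... | yes c≤1+i = begin
  𝟙 (suc i <ᵇ c) + countBelow c (map (skip (suc i)) π)
    ≡⟨ cong₂ _+_ (cong 𝟙 (<ᵇ-false c≤1+i)) (countBelow-skip-low π c≤1+i) ⟩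
  countBelow c π
    ≡⟨ countBelow-IsPerm π-perm (≤-trans c≤1+i (s≤s i≤n)) ⟩
  c ∸ 1 ∎
... | no c≰1+i with c | ≰⇒> c≰1+i
...   | suc (suc c′) | s<s 1+i≤1+c′ = begin
  𝟙 (suc i <ᵇ suc (suc c′)) + countBelow (suc (suc c′)) (map (skip (suc i)) π)
    ≡⟨ cong₂ _+_ (cong 𝟙 (<ᵇ-true (s<s 1+i≤1+c′))) (countBelow-skip-high π 1+i≤1+c′) ⟩
  suc (countBelow (suc c′) π)
    ≡⟨ cong suc (countBelow-IsPerm π-perm (s≤s⁻¹ c≤1+n)) ⟩
  suc (suc c′) ∸ 1 ∎

newOccurrences : ℕ → ℕ → ℕ
newOccurrences i j = if j <ᵇ i then 0 else i

occurrences′-◃◃ : ∀ {n i j ρ} → IsPerm n ρ → i ≤ suc n → j ≤ n →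
  occurrences′ (suc i ◃ (suc j ◃ ρ)) ≡ newOccurrences i j + occurrences′ (suc j ◃ ρ)
occurrences′-◃◃ {n} {i} {j} {ρ} ρ-perm i≤1+n j≤n = cong₂ _+_ new (occurrences′-skip (suc i) (suc j ◃ ρ))
  where
  r = map (skip (suc j)) ρ
  new : (if suc i <ᵇ skip (suc i) (suc j) then countBelow (suc i) (map (skip (suc i)) r) else 0)
      ≡ newOccurrences i j
  new with j <ᵇ i | <ᵇ-reflects-< j i
  ... | true  | ofʸ j<i =
    cong (λ b → if b then countBelow (suc i) (map (skip (suc i)) r) else 0) (<ᵇ-false (<⇒≤ j<i))
  ... | false | ofⁿ j≮i = begin
    (if i <ᵇ suc j then countBelow (suc i) (map (skip (suc i)) r) else 0)
      ≡⟨ cong (λ b → if b then countBelow (suc i) (map (skip (suc i)) r) else 0) (<ᵇ-true (s≤s (≮⇒≥ j≮i))) ⟩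
    countBelow (suc i) (map (skip (suc i)) r)
      ≡⟨ countBelow-skip-low {suc i} r ≤-refl ⟩
    countBelow (suc i) r
      ≡⟨ cong (_+ countBelow (suc i) r) (cong 𝟙 (<ᵇ-false (≮⇒≥ j≮i))) ⟨
    countBelow (suc i) (suc j ◃ ρ)
      ≡⟨ countBelow-IsPerm (prepend j≤n ρ-perm) (s≤s i≤1+n) ⟩
    i ∎

-- First-letter recurrences

byHead : (ℕ → ℕ) → ℕ → ℕ → ℕ
byHead Φ n i = sumPerms n (λ π → Φ (occurrences′ (suc i ◃ π)))

byHead-suc : ∀ Φ m {i} → i ≤ suc m →
  byHead Φ (suc m) i ≡ ∑[ j < suc m ] byHead (Φ ∘ (newOccurrences i j +_)) m j
byHead-suc Φ m {i} i≤1+m = begin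
  byHead Φ (suc m) i
    ≡⟨ sumPerms-suc m (λ π → Φ (occurrences′ (suc i ◃ π))) ⟩
  ∑[ j < suc m ] sumPerms m (λ ρ → Φ (occurrences′ (suc i ◃ (suc j ◃ ρ))))
    ≡⟨ ∑<-cong (suc m) (λ j j≤m → sumPerms-congᴾ m (λ ρ ρ-perm →
         cong Φ (occurrences′-◃◃ ρ-perm i≤1+m (s≤s⁻¹ j≤m)))) ⟩
  ∑[ j < suc m ] byHead (Φ ∘ (newOccurrences i j +_)) m j ∎

avoiding oneOccurrence : ℕ → ℕ → ℕ
avoiding      = byHead (λ o → 𝟙 (o ≡ᵇ 0))
oneOccurrence = byHead (λ o → 𝟙 (o ≡ᵇ 1))

𝟙-+-≡ᵇ0 : ∀ e o → 𝟙 (e + o ≡ᵇ 0) ≡ 𝟙 (e ≡ᵇ 0) * 𝟙 (o ≡ᵇ 0)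
𝟙-+-≡ᵇ0 zero    zero    = refl
𝟙-+-≡ᵇ0 zero    (suc o) = refl
𝟙-+-≡ᵇ0 (suc e) o       = refl

𝟙-+-≡ᵇ1 : ∀ e o → 𝟙 (e + o ≡ᵇ 1) ≡ 𝟙 (e ≡ᵇ 0) * 𝟙 (o ≡ᵇ 1) + 𝟙 (e ≡ᵇ 1) * 𝟙 (o ≡ᵇ 0)
𝟙-+-≡ᵇ1 zero          zero          = refl
𝟙-+-≡ᵇ1 zero          (suc zero)    = refl
𝟙-+-≡ᵇ1 zero          (suc (suc o)) = refl
𝟙-+-≡ᵇ1 (suc zero)    zero          = refl
𝟙-+-≡ᵇ1 (suc zero)    (suc o)       = refl
𝟙-+-≡ᵇ1 (suc (suc e)) o             = refl

avoiding-suc : ∀ m {i} → i ≤ suc m →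
  avoiding (suc m) i ≡ ∑[ j < suc m ] (𝟙 (newOccurrences i j ≡ᵇ 0) * avoiding m j)
avoiding-suc m {i} i≤1+m = trans (byHead-suc (λ o → 𝟙 (o ≡ᵇ 0)) m i≤1+m) (∑<-cong (suc m) (λ j _ → split j))
  where
  split : ∀ j → byHead (λ o → 𝟙 (newOccurrences i j + o ≡ᵇ 0)) m j ≡ 𝟙 (newOccurrences i j ≡ᵇ 0) * avoiding m j
  split j = trans (sumPerms-cong m (λ π → 𝟙-+-≡ᵇ0 (newOccurrences i j) (occurrences′ (suc j ◃ π))))
                  (sumPerms-*ˡ m (𝟙 (newOccurrences i j ≡ᵇ 0)) (λ π → 𝟙 (occurrences′ (suc j ◃ π) ≡ᵇ 0)))

oneOccurrence-suc : ∀ m {i} → i ≤ suc m →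
  oneOccurrence (suc m) i ≡ ∑[ j < suc m ] (𝟙 (newOccurrences i j ≡ᵇ 0) * oneOccurrence m j
                                           + 𝟙 (newOccurrences i j ≡ᵇ 1) * avoiding m j)
oneOccurrence-suc m {i} i≤1+m = trans (byHead-suc (λ o → 𝟙 (o ≡ᵇ 1)) m i≤1+m) (∑<-cong (suc m) (λ j _ → split j))
  where
  split : ∀ j → byHead (λ o → 𝟙 (newOccurrences i j + o ≡ᵇ 1)) m j
              ≡ 𝟙 (newOccurrences i j ≡ᵇ 0) * oneOccurrence m j + 𝟙 (newOccurrences i j ≡ᵇ 1) * avoiding m j
  split j = begin
    byHead (λ o → 𝟙 (e + o ≡ᵇ 1)) m j
      ≡⟨ sumPerms-cong m (λ π → 𝟙-+-≡ᵇ1 e (occurrences′ (suc j ◃ π))) ⟩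
    sumPerms m (λ π → 𝟙 (e ≡ᵇ 0) * 𝟙 (o π ≡ᵇ 1) + 𝟙 (e ≡ᵇ 1) * 𝟙 (o π ≡ᵇ 0))
      ≡⟨ sumPerms-+ m (λ π → 𝟙 (e ≡ᵇ 0) * 𝟙 (o π ≡ᵇ 1)) (λ π → 𝟙 (e ≡ᵇ 1) * 𝟙 (o π ≡ᵇ 0)) ⟩
    sumPerms m (λ π → 𝟙 (e ≡ᵇ 0) * 𝟙 (o π ≡ᵇ 1)) + sumPerms m (λ π → 𝟙 (e ≡ᵇ 1) * 𝟙 (o π ≡ᵇ 0))
      ≡⟨ cong₂ _+_ (sumPerms-*ˡ m (𝟙 (e ≡ᵇ 0)) (λ π → 𝟙 (o π ≡ᵇ 1)))
                   (sumPerms-*ˡ m (𝟙 (e ≡ᵇ 1)) (λ π → 𝟙 (o π ≡ᵇ 0))) ⟩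
    𝟙 (e ≡ᵇ 0) * oneOccurrence m j + 𝟙 (e ≡ᵇ 1) * avoiding m j ∎
    where
    e = newOccurrences i j
    o = λ π → occurrences′ (suc j ◃ π)

𝟙-newOccurrences≡0 : ∀ i j → 𝟙 (newOccurrences i j ≡ᵇ 0) ≡ 𝟙 (j <ᵇ i) + 𝟙 (i ≡ᵇ 0)
𝟙-newOccurrences≡0 zero    j = refl
𝟙-newOccurrences≡0 (suc i) j with j <ᵇ suc i
... | true  = refl
... | false = refl

𝟙-newOccurrences≡1 : ∀ i j → 𝟙 (newOccurrences i j ≡ᵇ 1) ≡ 𝟙 (i ≡ᵇ 1) * 𝟙 (0 <ᵇ j)
𝟙-newOccurrences≡1 zero          j       = refl
𝟙-newOccurrences≡1 (suc zero)    zero    = refl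
𝟙-newOccurrences≡1 (suc zero)    (suc j) = refl
𝟙-newOccurrences≡1 (suc (suc i)) j with j <ᵇ suc (suc i)
... | true  = refl
... | false = refl

module FirstLetterRecurrence (X : ℕ → ℕ → ℕ) (I : ℕ → ℕ)
  (X-suc : ∀ m {i} → i ≤ suc m →
           X (suc m) i ≡ ∑[ j < suc m ] (𝟙 (newOccurrences i j ≡ᵇ 0) * X m j) + 𝟙 (i ≡ᵇ 1) * I m) where

  total : ℕ → ℕ
  total m = ∑< (suc m) (X m)

  X-suc-split : ∀ m {i} → i ≤ suc m →
    X (suc m) i ≡ ∑[ j < suc m ] (𝟙 (j <ᵇ i) * X m j) + 𝟙 (i ≡ᵇ 0) * total m + 𝟙 (i ≡ᵇ 1) * I m
  X-suc-split m {i} i≤1+m = trans (X-suc m i≤1+m) (cong (_+ 𝟙 (i ≡ᵇ 1) * I m) (begin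
    ∑[ j < suc m ] (𝟙 (newOccurrences i j ≡ᵇ 0) * X m j)
      ≡⟨ ∑<-cong (suc m) (λ j _ → trans (cong (_* X m j) (𝟙-newOccurrences≡0 i j))
                                         (*-distribʳ-+ (X m j) (𝟙 (j <ᵇ i)) (𝟙 (i ≡ᵇ 0)))) ⟩
    ∑[ j < suc m ] (𝟙 (j <ᵇ i) * X m j + 𝟙 (i ≡ᵇ 0) * X m j)
      ≡⟨ ∑<-+ (suc m) (λ j → 𝟙 (j <ᵇ i) * X m j) (λ j → 𝟙 (i ≡ᵇ 0) * X m j) ⟩
    ∑[ j < suc m ] (𝟙 (j <ᵇ i) * X m j) + ∑[ j < suc m ] (𝟙 (i ≡ᵇ 0) * X m j)
      ≡⟨ cong (∑[ j < suc m ] (𝟙 (j <ᵇ i) * X m j) +_) (∑<-*ˡ (suc m) (𝟙 (i ≡ᵇ 0)) (X m)) ⟩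
    ∑[ j < suc m ] (𝟙 (j <ᵇ i) * X m j) + 𝟙 (i ≡ᵇ 0) * total m ∎))

  X-suc-zero : ∀ m → X (suc m) 0 ≡ total m
  X-suc-zero m = begin
    X (suc m) 0                         ≡⟨ X-suc m z≤n ⟩
    ∑[ j < suc m ] (1 * X m j) + 0      ≡⟨ +-identityʳ _ ⟩
    ∑[ j < suc m ] (1 * X m j)          ≡⟨ ∑<-cong (suc m) (λ j _ → *-identityˡ (X m j)) ⟩
    total m                             ∎

  weight : ℕ → ℕ → ℕ
  weight r t = (t + r) C t

  -- With these weights the triangular sum in X-suc collapses by the hockey-stick identity.
  moment : ℕ → ℕ → ℕ
  moment r m = ∑[ i < suc m ] (weight r (m ∸ i) * X m i)

  ∑<-weight-above : ∀ r m {j} → j ≤ m →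
    ∑[ i < suc (suc m) ] (𝟙 (j <ᵇ i) * weight r (suc m ∸ i)) ≡ weight (suc r) (m ∸ j)
  ∑<-weight-above r m {j} j≤m = begin
    ∑[ i < suc (suc m) ] (𝟙 (j <ᵇ i) * weight r (suc m ∸ i))  ≡⟨ ∑<-above (suc m) j (weight r) ⟩
    ∑< (suc m ∸ j) (weight r)                                  ≡⟨ cong (λ n → ∑< n (weight r)) (+-∸-assoc 1 j≤m) ⟩
    ∑< (suc (m ∸ j)) (weight r)                                ≡⟨ ∑<-C-hockey (m ∸ j) r ⟩
    weight (suc r) (m ∸ j)                                     ∎

  moment-earlier : ∀ r m →
    ∑[ i < suc (suc m) ] (weight r (suc m ∸ i) * ∑[ j < suc m ] (𝟙 (j <ᵇ i) * X m j)) ≡ moment (suc r) m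
  moment-earlier r m = begin
    ∑[ i < suc (suc m) ] (w i * ∑[ j < suc m ] (𝟙 (j <ᵇ i) * X m j))
      ≡⟨ ∑<-cong (suc (suc m)) (λ i _ → ∑<-*ˡ (suc m) (w i) (λ j → 𝟙 (j <ᵇ i) * X m j)) ⟨
    ∑[ i < suc (suc m) ] ∑[ j < suc m ] (w i * (𝟙 (j <ᵇ i) * X m j))
      ≡⟨ ∑<-comm (suc (suc m)) (suc m) (λ i j → w i * (𝟙 (j <ᵇ i) * X m j)) ⟩
    ∑[ j < suc m ] ∑[ i < suc (suc m) ] (w i * (𝟙 (j <ᵇ i) * X m j))
      ≡⟨ ∑<-cong (suc m) (λ j j≤m → begin
           ∑[ i < suc (suc m) ] (w i * (𝟙 (j <ᵇ i) * X m j))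
             ≡⟨ ∑<-cong (suc (suc m)) (λ i _ → *-rotate (w i) (𝟙 (j <ᵇ i)) (X m j)) ⟩
           ∑[ i < suc (suc m) ] (X m j * (𝟙 (j <ᵇ i) * w i))
             ≡⟨ ∑<-*ˡ (suc (suc m)) (X m j) (λ i → 𝟙 (j <ᵇ i) * w i) ⟩
           X m j * ∑[ i < suc (suc m) ] (𝟙 (j <ᵇ i) * w i)
             ≡⟨ cong (X m j *_) (∑<-weight-above r m (s≤s⁻¹ j≤m)) ⟩
           X m j * weight (suc r) (m ∸ j)
             ≡⟨ *-comm (X m j) _ ⟩
           weight (suc r) (m ∸ j) * X m j ∎) ⟩
    moment (suc r) m ∎
    where
    w : ℕ → ℕ
    w i = weight r (suc m ∸ i)

  moment-suc : ∀ r m → moment r (suc m) ≡ moment (suc r) m + weight r (suc m) * total m + weight r m * I m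
  moment-suc r m = begin
    ∑[ i < suc (suc m) ] (w i * X (suc m) i)
      ≡⟨ ∑<-cong (suc (suc m)) (λ i i≤1+m → trans (cong (w i *_) (X-suc-split m (s≤s⁻¹ i≤1+m))) (distrib i)) ⟩
    ∑[ i < suc (suc m) ] (w i * earlier i + w i * (𝟙 (i ≡ᵇ 0) * total m) + w i * (𝟙 (i ≡ᵇ 1) * I m))
      ≡⟨ ∑<-+ (suc (suc m)) (λ i → w i * earlier i + w i * (𝟙 (i ≡ᵇ 0) * total m))
                            (λ i → w i * (𝟙 (i ≡ᵇ 1) * I m)) ⟩
    ∑[ i < suc (suc m) ] (w i * earlier i + w i * (𝟙 (i ≡ᵇ 0) * total m))
      + ∑[ i < suc (suc m) ] (w i * (𝟙 (i ≡ᵇ 1) * I m))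
      ≡⟨ cong (_+ ∑[ i < suc (suc m) ] (w i * (𝟙 (i ≡ᵇ 1) * I m)))
              (∑<-+ (suc (suc m)) (λ i → w i * earlier i) (λ i → w i * (𝟙 (i ≡ᵇ 0) * total m))) ⟩
    ∑[ i < suc (suc m) ] (w i * earlier i) + ∑[ i < suc (suc m) ] (w i * (𝟙 (i ≡ᵇ 0) * total m))
      + ∑[ i < suc (suc m) ] (w i * (𝟙 (i ≡ᵇ 1) * I m))
      ≡⟨ cong₂ _+_ (cong₂ _+_ (moment-earlier r m) (∑<-indicator {suc (suc m)} w (total m) z<s))
                   (∑<-indicator {suc (suc m)} w (I m) (s<s z<s)) ⟩
    moment (suc r) m + weight r (suc m) * total m + weight r m * I m ∎
    where
    w : ℕ → ℕ
    w i = weight r (suc m ∸ i)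
    earlier : ℕ → ℕ
    earlier i = ∑[ j < suc m ] (𝟙 (j <ᵇ i) * X m j)
    distrib : ∀ i → w i * (earlier i + 𝟙 (i ≡ᵇ 0) * total m + 𝟙 (i ≡ᵇ 1) * I m)
                  ≡ w i * earlier i + w i * (𝟙 (i ≡ᵇ 0) * total m) + w i * (𝟙 (i ≡ᵇ 1) * I m)
    distrib i = trans (*-distribˡ-+ (w i) (earlier i + 𝟙 (i ≡ᵇ 0) * total m) (𝟙 (i ≡ᵇ 1) * I m))
                      (cong (_+ w i * (𝟙 (i ≡ᵇ 1) * I m)) (*-distribˡ-+ (w i) (earlier i) (𝟙 (i ≡ᵇ 0) * total m)))

  moment-closed : ∀ m r →
    moment r m ≡ X 0 0 + ∑[ s < m ] (((m + r) C suc s) * total s + ((m ∸ 1 + r) C s) * I s)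
  moment-closed zero    r = cong (_+ 0) (+-identityʳ (X 0 0))
  moment-closed (suc m) r = begin
    moment r (suc m)
      ≡⟨ trans (moment-suc r m) (+-assoc (moment (suc r) m) _ _) ⟩
    moment (suc r) m + F m
      ≡⟨ cong (_+ F m) (moment-closed m (suc r)) ⟩
    X 0 0 + ∑[ s < m ] (((m + suc r) C suc s) * total s + ((m ∸ 1 + suc r) C s) * I s) + F m
      ≡⟨ cong (λ z → X 0 0 + z + F m) (∑<-cong m (λ s s<m →
           cong₂ (λ a b → (a C suc s) * total s + (b C s) * I s) (+-suc m r) (shift s<m))) ⟩
    X 0 0 + ∑< m F + F m
      ≡⟨ +-assoc (X 0 0) (∑< m F) (F m) ⟩
    X 0 0 + (∑< m F + F m)
      ≡⟨ cong (X 0 0 +_) (∑<-suc m F) ⟨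
    X 0 0 + ∑< (suc m) F ∎
    where
    F : ℕ → ℕ
    F s = ((suc m + r) C suc s) * total s + ((m + r) C s) * I s
    shift : ∀ {n s} → s < n → n ∸ 1 + suc r ≡ n + r
    shift {suc n} _ = +-suc n r

  total-closed : ∀ m → total m ≡ X 0 0 + ∑[ s < m ] ((m C suc s) * total s + ((m ∸ 1) C s) * I s)
  total-closed m = begin
    total m
      ≡⟨ ∑<-cong (suc m) (λ i _ → trans (cong (_* X m i) (weight-zero (m ∸ i))) (*-identityˡ (X m i))) ⟨
    moment 0 m
      ≡⟨ moment-closed m 0 ⟩
    X 0 0 + ∑[ s < m ] (((m + 0) C suc s) * total s + ((m ∸ 1 + 0) C s) * I s)
      ≡⟨ cong (X 0 0 +_) (∑<-cong m (λ s _ →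
           cong₂ (λ a b → (a C suc s) * total s + (b C s) * I s) (+-identityʳ m) (+-identityʳ (m ∸ 1)))) ⟩
    X 0 0 + ∑[ s < m ] ((m C suc s) * total s + ((m ∸ 1) C s) * I s) ∎
    where
    weight-zero : ∀ t → weight 0 t ≡ 1
    weight-zero t = trans (cong (_C t) (+-identityʳ t)) (nCn≡1 t)

avoidingHead≥2 : ℕ → ℕ
avoidingHead≥2 m = ∑[ j < suc m ] (𝟙 (0 <ᵇ j) * avoiding m j)

module Avoiding = FirstLetterRecurrence avoiding (λ _ → 0) (λ m {i} i≤1+m →
  trans (avoiding-suc m i≤1+m)
        (sym (trans (cong (∑[ j < suc m ] (𝟙 (newOccurrences i j ≡ᵇ 0) * avoiding m j) +_)
                          (*-zeroʳ (𝟙 (i ≡ᵇ 1))))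
                    (+-identityʳ _))))

oneOccurrence-suc′ : ∀ m {i} → i ≤ suc m → oneOccurrence (suc m) i
  ≡ ∑[ j < suc m ] (𝟙 (newOccurrences i j ≡ᵇ 0) * oneOccurrence m j) + 𝟙 (i ≡ᵇ 1) * avoidingHead≥2 m
oneOccurrence-suc′ m {i} i≤1+m = begin
  oneOccurrence (suc m) i
    ≡⟨ oneOccurrence-suc m i≤1+m ⟩
  ∑[ j < suc m ] (𝟙 (newOccurrences i j ≡ᵇ 0) * oneOccurrence m j + 𝟙 (newOccurrences i j ≡ᵇ 1) * avoiding m j)
    ≡⟨ ∑<-+ (suc m) (λ j → 𝟙 (newOccurrences i j ≡ᵇ 0) * oneOccurrence m j)
                    (λ j → 𝟙 (newOccurrences i j ≡ᵇ 1) * avoiding m j) ⟩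
  ∑[ j < suc m ] (𝟙 (newOccurrences i j ≡ᵇ 0) * oneOccurrence m j)
    + ∑[ j < suc m ] (𝟙 (newOccurrences i j ≡ᵇ 1) * avoiding m j)
    ≡⟨ cong (∑[ j < suc m ] (𝟙 (newOccurrences i j ≡ᵇ 0) * oneOccurrence m j) +_) (begin
         ∑[ j < suc m ] (𝟙 (newOccurrences i j ≡ᵇ 1) * avoiding m j)
           ≡⟨ ∑<-cong (suc m) (λ j _ → trans (cong (_* avoiding m j) (𝟙-newOccurrences≡1 i j))
                                             (*-assoc (𝟙 (i ≡ᵇ 1)) (𝟙 (0 <ᵇ j)) (avoiding m j))) ⟩
         ∑[ j < suc m ] (𝟙 (i ≡ᵇ 1) * (𝟙 (0 <ᵇ j) * avoiding m j))
           ≡⟨ ∑<-*ˡ (suc m) (𝟙 (i ≡ᵇ 1)) (λ j → 𝟙 (0 <ᵇ j) * avoiding m j) ⟩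
         𝟙 (i ≡ᵇ 1) * avoidingHead≥2 m ∎) ⟩
  ∑[ j < suc m ] (𝟙 (newOccurrences i j ≡ᵇ 0) * oneOccurrence m j) + 𝟙 (i ≡ᵇ 1) * avoidingHead≥2 m ∎

module OneOccurrence = FirstLetterRecurrence oneOccurrence avoidingHead≥2 oneOccurrence-suc′

avoiding-bell : ∀ m → Avoiding.total m ≡ bell (suc m)
avoiding-bell = <-rec _ λ m rec → begin
  Avoiding.total m
    ≡⟨ Avoiding.total-closed m ⟩
  1 + ∑[ s < m ] ((m C suc s) * Avoiding.total s + ((m ∸ 1) C s) * 0)
    ≡⟨ cong (1 +_) (∑<-cong m (λ s s<m →
         trans (cong₂ (λ a b → (m C suc s) * a + b) (rec s<m) (*-zeroʳ ((m ∸ 1) C s))) (+-identityʳ _))) ⟩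
  binomialTransform bell m
    ≡⟨ binomialTransform-bell m ⟩
  bell (suc m) ∎

avoidingHead≥2-weightedStirling : ∀ m → avoidingHead≥2 m ≡ weightedStirling m
avoidingHead≥2-weightedStirling zero    = refl
avoidingHead≥2-weightedStirling (suc m) = +-cancelʳ-≡ (bell (suc m)) _ _ $ begin
  avoidingHead≥2 (suc m) + bell (suc m)
    ≡⟨ cong (avoidingHead≥2 (suc m) +_) (trans (sym (avoiding-bell m)) (sym (Avoiding.X-suc-zero m))) ⟩
  avoidingHead≥2 (suc m) + avoiding (suc m) 0
    ≡⟨ +-comm (avoidingHead≥2 (suc m)) _ ⟩
  avoiding (suc m) 0 + ∑[ j < suc m ] (1 * avoiding (suc m) (suc j))
    ≡⟨ cong (avoiding (suc m) 0 +_) (∑<-cong (suc m) (λ j _ → *-identityˡ (avoiding (suc m) (suc j)))) ⟩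
  Avoiding.total (suc m)
    ≡⟨ avoiding-bell (suc m) ⟩
  bell (suc (suc m))
    ≡⟨ bell-suc (suc m) ⟩
  weightedStirling (suc m) + bell (suc m) ∎

∑<-binomial-avoidingHead≥2 : ∀ m → ∑[ s < m ] (((m ∸ 1) C s) * avoidingHead≥2 s) ≡ weightedStirling⁺ m
∑<-binomial-avoidingHead≥2 zero    = refl
∑<-binomial-avoidingHead≥2 (suc m) =
  trans (binomialTransform-cong m (λ s _ → avoidingHead≥2-weightedStirling s))
        (binomialTransform-weightedStirling m)

v₁-total : ∀ m → v₁ (suc m) ≡ OneOccurrence.total m
v₁-total m = begin
  v₁ (suc m)
    ≡⟨ length-filter (λ w → occurrences w ≟ 1) (perms (suc m)) ⟩
  sumPerms (suc m) (λ π → 𝟙 (occurrences π ≡ᵇ 1))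
    ≡⟨ sumPerms-cong (suc m) (λ π → cong (λ o → 𝟙 (o ≡ᵇ 1)) (occurrences≡occurrences′ π)) ⟩
  sumPerms (suc m) (λ π → 𝟙 (occurrences′ π ≡ᵇ 1))
    ≡⟨ sumPerms-suc m (λ π → 𝟙 (occurrences′ π ≡ᵇ 1)) ⟩
  OneOccurrence.total m ∎

v₁-suc : ∀ m → v₁ (suc m) ≡ binomialTransform v₁ m + weightedStirling⁺ m
v₁-suc m = begin
  v₁ (suc m)
    ≡⟨ v₁-total m ⟩
  OneOccurrence.total m
    ≡⟨ OneOccurrence.total-closed m ⟩
  ∑[ s < m ] ((m C suc s) * OneOccurrence.total s + ((m ∸ 1) C s) * avoidingHead≥2 s)
    ≡⟨ ∑<-+ m (λ s → (m C suc s) * OneOccurrence.total s) (λ s → ((m ∸ 1) C s) * avoidingHead≥2 s) ⟩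
  ∑[ s < m ] ((m C suc s) * OneOccurrence.total s) + ∑[ s < m ] (((m ∸ 1) C s) * avoidingHead≥2 s)
    ≡⟨ cong₂ _+_ (∑<-cong m (λ s _ → cong ((m C suc s) *_) (v₁-total s)))
                 (sym (∑<-binomial-avoidingHead≥2 m)) ⟨
  binomialTransform v₁ m + weightedStirling⁺ m ∎

corollary4 : (N : ℕ) → V₁ N ≡ rhs N
corollary4 = <-rec _ λ where
  zero    _   → refl
  (suc m) rec → begin
    v₁ (suc m)
      ≡⟨ v₁-suc m ⟩
    binomialTransform v₁ m + weightedStirling⁺ m
      ≡⟨ cong (_+ weightedStirling⁺ m) (binomialTransform-cong m (λ M M≤m → rec (s≤s M≤m))) ⟩
    binomialTransform rhs m + weightedStirling⁺ m
      ≡⟨ rhs-suc m ⟨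
    rhs (suc m) ∎
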